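{- Let $(a_n)_{n\ge1}$ and $(b_n)_{n\ge1}$ be sequences of positive integers and put $c_n=\frac{a_n}{b_n}>0$. Assume: (1) $b_n \mid b_{n+1}$ for all $n=1,2,\dots$; (2) $\lim_{n\to\infty} a_n\frac{c_{n+1}}{c_n}=0$. Then the series $\sum_{n=1}^{\infty}c_n$ converges to an irrational number. -}

module Defs where

open import Data.Nat as ℕ using (ℕ; zero; suc)
open import Data.Integer using (+_)
open import Data.Rational using (ℚ; _/_; _+_; _-_; _*_; _÷_; ∣_∣; _<_; _>_; 0ℚ; NonZero)
open import Data.Rational.Properties using (normalize-pos; pos⇒nonZero)
open import Data.Product using (∃-syntax; _×_)
open import Relation.Nullary using (¬_)

-- Paper index n = 1,2,3,... is represented by Agda index n-1 = 0,1,2,...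

c : (a b : ℕ → ℕ) → (∀ n → ℕ.NonZero (b n)) → ℕ → ℚ
c a b bpos n = (+ a n / b n) {{bpos n}}

c-nonZero : (a b : ℕ → ℕ) (apos : ∀ n → ℕ.NonZero (a n)) (bpos : ∀ n → ℕ.NonZero (b n))
            → ∀ n → NonZero (c a b bpos n)
c-nonZero a b apos bpos n =
  pos⇒nonZero (c a b bpos n) {{normalize-pos (a n) (b n) {{bpos n}} {{apos n}}}}

ratioTerm : (a b : ℕ → ℕ) (apos : ∀ n → ℕ.NonZero (a n)) (bpos : ∀ n → ℕ.NonZero (b n))
            → ℕ → ℚ
ratioTerm a b apos bpos n =
  (+ a n / 1) * (c a b bpos (suc n) ÷ c a b bpos n) {{c-nonZero a b apos bpos n}}

partialSum : (ℕ → ℚ) → ℕ → ℚ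
partialSum f zero = 0ℚ
partialSum f (suc N) = partialSum f N + f N

ConvergesTo : (ℕ → ℚ) → ℚ → Set
ConvergesTo s L = ∀ (ε : ℚ) → ε > 0ℚ → ∃[ N ] ∀ n → N ℕ.≤ n → ∣ s n - L ∣ < ε

-- a rational sequence is Cauchy (i.e. converges to a real number)
Cauchy : (ℕ → ℚ) → Set
Cauchy s = ∀ (ε : ℚ) → ε > 0ℚ → ∃[ N ] ∀ m n → N ℕ.≤ m → N ℕ.≤ n → ∣ s m - s n ∣ < ε

ConvergesToIrrational : (ℕ → ℚ) → Set
ConvergesToIrrational s = Cauchy s × (∀ (q : ℚ) → ¬ ConvergesTo s q)

-- Since aₙ = bₙ cₙ we have Rₙ = bₙ cₙ₊₁ and Rₙ cₙ = aₙ cₙ₊₁.  Because aₙ, bₙ ≥ 1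
-- this gives cₙ₊₁ ≤ Rₙ, so cₙ → 0, and once Rₙ < ½ also 2cₙ₊₁ ≤ cₙ: the terms
-- eventually at least halve.  A nonnegative eventually-halving sequence tending
-- to 0 has Cauchy partial sums Sₙ, and any limit L satisfies cₙ ≤ L - Sₙ ≤ 2cₙ
-- from the halving index on.  If L = p/q were rational, then for large n the
-- number  X = q bₙ (L - Sₙ₊₁)  is an integer (q L = p, and bₙ Sₙ₊₁ is a sum of
-- the integers (bₙ/bₘ) aₘ because bₘ ∣ bₙ), while 0 < X ≤ 2 q bₙ cₙ₊₁ = 2 q Rₙ < 1.
module Submission where

open import Data.Nat as ℕ using (ℕ; zero; suc; _≤′_; ≤′-refl; ≤′-step)
import Data.Nat.Properties as ℕP
open import Data.Nat.Divisibility using (_∣_; divides; ∣-refl; ∣-trans)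
open import Data.Integer as ℤ using (+_; +0; +[1+_]; -[1+_])
import Data.Integer.Properties as ℤP
open import Data.Integer.Tactic.RingSolver using (solve-∀)
open import Data.Rational
open import Data.Rational.Literals using (fromℤ)
open import Data.Rational.Properties
import Data.Rational.Unnormalised as ℚᵘ
import Data.Rational.Unnormalised.Properties as ℚᵘP
open import Data.Rational.Solver using (module +-*-Solver)
open import Data.Product using (∃-syntax; _×_; _,_; proj₁; proj₂)
open import Data.Sum using (inj₁; inj₂)
open import Data.Empty using (⊥)
open import Relation.Nullary using (¬_; yes; no; contradiction)
open import Relation.Binary.PropositionalEquality
open import Defs

open +-*-Solver using (solve; _:+_; _:*_; _:-_; :-_; _:=_; con)

fromℤ-+ : ∀ x y → fromℤ x + fromℤ y ≡ fromℤ (x ℤ.+ y)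
fromℤ-+ x y = toℚᵘ-injective (ℚᵘP.≃-trans (toℚᵘ-homo-+ (fromℤ x) (fromℤ y)) (ℚᵘ.*≡* (cross x y)))
  where
  cross : ∀ x y → (x ℤ.* + 1 ℤ.+ y ℤ.* + 1) ℤ.* + 1 ≡ (x ℤ.+ y) ℤ.* + 1
  cross = solve-∀

fromℤ-* : ∀ x y → fromℤ x * fromℤ y ≡ fromℤ (x ℤ.* y)
fromℤ-* x y = toℚᵘ-injective (ℚᵘP.≃-trans (toℚᵘ-homo-* (fromℤ x) (fromℤ y)) (ℚᵘ.*≡* refl))

fromℤ-neg : ∀ x → - fromℤ x ≡ fromℤ (ℤ.- x)
fromℤ-neg x = toℚᵘ-injective (toℚᵘ-homo‿- (fromℤ x))

z/1≡fromℤ : ∀ z → z / 1 ≡ fromℤ z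
z/1≡fromℤ z = ↥p/↧p≡p (fromℤ z)

fromℤ-cancel : ∀ z d .{{_ : ℕ.NonZero d}} → fromℤ (+ d) * (z / d) ≡ fromℤ z
fromℤ-cancel z (suc d) = toℚᵘ-injective (begin
  toℚᵘ (fromℤ (+ suc d) * (z / suc d))         ≈⟨ toℚᵘ-homo-* (fromℤ (+ suc d)) (z / suc d) ⟩
  ℚᵘ.mkℚᵘ (+ suc d) 0 ℚᵘ.* toℚᵘ (z / suc d)   ≈⟨ ℚᵘP.*-congˡ (toℚᵘ-fromℚᵘ (ℚᵘ.mkℚᵘ z d)) ⟩
  ℚᵘ.mkℚᵘ (+ suc d) 0 ℚᵘ.* ℚᵘ.mkℚᵘ z d       ≈⟨ ℚᵘ.*≡* (trans (cross (+ suc d) z) (cong (z ℤ.*_) (sym (ℤP.pos-* 1 (suc d))))) ⟩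
  ℚᵘ.mkℚᵘ z 0                                  ∎)
  where
  open ℚᵘP.≃-Reasoning
  cross : ∀ n z → (n ℤ.* z) ℤ.* + 1 ≡ z ℤ.* (+ 1 ℤ.* n)
  cross = solve-∀

IsInteger : ℚ → Set
IsInteger q = ∃[ z ] q ≡ fromℤ z

integer-+ : ∀ {p q} → IsInteger p → IsInteger q → IsInteger (p + q)
integer-+ (x , refl) (y , refl) = x ℤ.+ y , fromℤ-+ x y

integer-* : ∀ {p q} → IsInteger p → IsInteger q → IsInteger (p * q)
integer-* (x , refl) (y , refl) = x ℤ.* y , fromℤ-* x y

integer-neg : ∀ {p} → IsInteger p → IsInteger (- p)
integer-neg (x , refl) = ℤ.- x , fromℤ-neg x

scaled-partialSum-integer : ∀ x f k → (∀ m → m ℕ.< k → IsInteger (x * f m)) →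
                            IsInteger (x * partialSum f k)
scaled-partialSum-integer x f zero    _     = +0 , *-zeroʳ x
scaled-partialSum-integer x f (suc k) terms =
  subst IsInteger (sym (*-distribˡ-+ x (partialSum f k) (f k)))
    (integer-+ (scaled-partialSum-integer x f k (λ m m<k → terms m (ℕP.m<n⇒m<1+n m<k)))
               (terms k ℕP.≤-refl))

denominator-clears : ∀ q → IsInteger (fromℤ (↧ q) * q)
denominator-clears q = ↥ q , (begin
  fromℤ (↧ q) * q               ≡⟨ cong (fromℤ (↧ q) *_) (↥p/↧p≡p q) ⟨
  fromℤ (↧ q) * (↥ q / ↧ₙ q)    ≡⟨ fromℤ-cancel (↥ q) (↧ₙ q) ⟩
  fromℤ (↥ q)                   ∎)
  where open ≡-Reasoning

no-integer-between-0-and-1 : ∀ {q} → IsInteger q → 0ℚ < q → q < 1ℚ → ⊥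
no-integer-between-0-and-1 (+0       , refl) (*<* (ℤ.+<+ ())) _
no-integer-between-0-and-1 (+[1+ k ] , refl) _ (*<* (ℤ.+<+ (ℕ.s≤s ())))
no-integer-between-0-and-1 (-[1+ k ] , refl) (*<* ()) _

1≤fromℕ : ∀ n .{{_ : ℕ.NonZero n}} → 1ℚ ≤ fromℤ (+ n)
1≤fromℕ (suc n) = *≤* (ℤ.+≤+ (ℕ.s≤s ℕ.z≤n))

p≤p+q : ∀ {p q} → 0ℚ ≤ q → p ≤ p + q
p≤p+q {p} 0≤q = subst (_≤ p + _) (+-identityʳ p) (+-monoʳ-≤ p 0≤q)

p≤∣p∣ : ∀ p → p ≤ ∣ p ∣
p≤∣p∣ p with 0ℚ ≤? p
... | yes 0≤p = ≤-reflexive (sym (0≤p⇒∣p∣≡p 0≤p))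
... | no  0≰p = ≤-trans (<⇒≤ (≰⇒> 0≰p)) (0≤∣p∣ p)

-p≤∣p∣ : ∀ p → - p ≤ ∣ p ∣
-p≤∣p∣ p = subst (- p ≤_) (∣-p∣≡∣p∣ p) (p≤∣p∣ (- p))

∣p-q∣≡∣q-p∣ : ∀ p q → ∣ p - q ∣ ≡ ∣ q - p ∣
∣p-q∣≡∣q-p∣ p q = begin
  ∣ p - q ∣        ≡⟨ ∣-p∣≡∣p∣ (p - q) ⟨
  ∣ - (p - q) ∣    ≡⟨ cong ∣_∣ (solve 2 (λ p q → :- (p :- q) := q :- p) refl p q) ⟩
  ∣ q - p ∣        ∎
  where open ≡-Reasoning

p<q⇒0<q-p : ∀ {p q} → p < q → 0ℚ < q - p
p<q⇒0<q-p {p} {q} p<q = subst (_< q - p) (+-inverseʳ p) (+-monoˡ-< (- p) p<q)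

p≤q⇒0≤q-p : ∀ {p q} → p ≤ q → 0ℚ ≤ q - p
p≤q⇒0≤q-p {p} {q} p≤q = subst (_≤ q - p) (+-inverseʳ p) (+-monoˡ-≤ (- p) p≤q)

p≤q+r⇒p-q≤r : ∀ {p q r} → p ≤ q + r → p - q ≤ r
p≤q+r⇒p-q≤r {p} {q} {r} h = subst (p - q ≤_) (solve 2 (λ q r → (q :+ r) :- q := r) refl q r) (+-monoˡ-≤ (- q) h)

q+r≤p⇒r≤p-q : ∀ {p q r} → q + r ≤ p → r ≤ p - q
q+r≤p⇒r≤p-q {p} {q} {r} h = subst (_≤ p - q) (solve 2 (λ q r → (q :+ r) :- q := r) refl q r) (+-monoˡ-≤ (- q) h)

½-pos : 0ℚ < ½
½-pos = *<* (ℤ.+<+ (ℕ.s≤s ℕ.z≤n))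

Eventually : (ℕ → Set) → Set
Eventually P = ∃[ N ] ∀ n → N ℕ.≤ n → P n

limit-≤ : ∀ {s L U} → ConvergesTo s L → Eventually (λ n → s n ≤ U) → L ≤ U
limit-≤ {s} {L} {U} s→L (M , bound) with L ≤? U
... | yes L≤U = L≤U
... | no  L≰U with s→L (L - U) (p<q⇒0<q-p (≰⇒> L≰U))
...   | N , close = contradiction (begin-strict
  L - U            ≤⟨ +-monoʳ-≤ L (neg-antimono-≤ (bound m (ℕP.m≤n⊔m N M))) ⟩
  L - s m          ≡⟨ solve 2 (λ L s → L :- s := :- (s :- L)) refl L (s m) ⟩
  - (s m - L)      ≤⟨ -p≤∣p∣ (s m - L) ⟩
  ∣ s m - L ∣      <⟨ close m (ℕP.m≤m⊔n N M) ⟩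
  L - U            ∎) (<-irrefl refl)
  where
  open ≤-Reasoning
  m = N ℕ.⊔ M

limit-≥ : ∀ {s L V} → ConvergesTo s L → Eventually (λ n → V ≤ s n) → V ≤ L
limit-≥ {s} {L} {V} s→L (M , bound) with V ≤? L
... | yes V≤L = V≤L
... | no  V≰L with s→L (V - L) (p<q⇒0<q-p (≰⇒> V≰L))
...   | N , close = contradiction (begin-strict
  V - L            ≤⟨ +-monoˡ-≤ (- L) (bound m (ℕP.m≤n⊔m N M)) ⟩
  s m - L          ≤⟨ p≤∣p∣ (s m - L) ⟩
  ∣ s m - L ∣      <⟨ close m (ℕP.m≤m⊔n N M) ⟩
  V - L            ∎) (<-irrefl refl)
  where
  open ≤-Reasoning
  m = N ℕ.⊔ M

→0⇒eventually-< : ∀ {s} → ConvergesTo s 0ℚ → ∀ ε → 0ℚ < ε → Eventually (λ n → s n < ε)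
→0⇒eventually-< {s} s→0 ε ε>0 with s→0 ε ε>0
... | N , close = N , λ n N≤n → ≤-<-trans (subst (_≤ ∣ s n - 0ℚ ∣) (+-identityʳ (s n)) (p≤∣p∣ (s n - 0ℚ))) (close n N≤n)

Halves : (ℕ → ℚ) → ℕ → Set
Halves f k = f (suc k) + f (suc k) ≤ f k

HalvingFrom : (ℕ → ℚ) → ℕ → Set
HalvingFrom f n = ∀ k → n ℕ.≤ k → Halves f k

module _ (f : ℕ → ℚ) (f≥0 : ∀ n → 0ℚ ≤ f n) where

  partialSum-mono : ∀ {m n} → m ℕ.≤ n → partialSum f m ≤ partialSum f n
  partialSum-mono m≤n = go (ℕP.≤⇒≤′ m≤n)
    where
    go : ∀ {m n} → m ≤′ n → partialSum f m ≤ partialSum f n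
    go ≤′-refl       = ≤-refl
    go (≤′-step m≤n) = ≤-trans (go m≤n) (p≤p+q (f≥0 _))

  -- While the terms halve, Sₘ + 2fₘ does not increase: adding fₘ to Sₘ
  -- costs at most the drop from 2fₘ to fₘ ≥ 2fₘ₊₁.
  tail-bound : ∀ {n m} → HalvingFrom f n → n ≤′ m →
               partialSum f m + (f m + f m) ≤ partialSum f n + (f n + f n)
  tail-bound halving ≤′-refl = ≤-refl
  tail-bound {n} {suc m} halving (≤′-step n≤m) = begin
    (S m + f m) + (f (suc m) + f (suc m))   ≤⟨ +-monoʳ-≤ (S m + f m) (halving m (ℕP.≤′⇒≤ n≤m)) ⟩
    (S m + f m) + f m                       ≡⟨ +-assoc (S m) (f m) (f m) ⟩
    S m + (f m + f m)                       ≤⟨ tail-bound halving n≤m ⟩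
    S n + (f n + f n)                       ∎
    where
    open ≤-Reasoning
    S = partialSum f

  partialSum-bounded : ∀ {n m} → HalvingFrom f n → n ℕ.≤ m →
                       partialSum f m ≤ partialSum f n + (f n + f n)
  partialSum-bounded halving n≤m =
    ≤-trans (p≤p+q (+-mono-≤ (f≥0 _) (f≥0 _))) (tail-bound halving (ℕP.≤⇒≤′ n≤m))

  -- If moreover f → 0, the partial sums form a Cauchy sequence:
  -- for n ≤ m beyond both thresholds, 0 ≤ Sₘ - Sₙ ≤ 2fₙ < ε.
  halving-series-cauchy : Eventually (Halves f) → ConvergesTo f 0ℚ → Cauchy (partialSum f)
  halving-series-cauchy (N , halving) f→0 ε ε>0 = M , close
    where
    S = partialSum f
    ½ε>0 : 0ℚ < ½ * ε
    ½ε>0 = positive⁻¹ (½ * ε) {{pos*pos⇒pos ½ ε {{positive ε>0}}}}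
    f-small : Eventually (λ n → f n < ½ * ε)
    f-small = →0⇒eventually-< {f} f→0 (½ * ε) ½ε>0
    N′ = proj₁ f-small
    M = N ℕ.⊔ N′

    ordered : ∀ m n → M ℕ.≤ n → n ℕ.≤ m → ∣ S m - S n ∣ < ε
    ordered m n M≤n n≤m = begin-strict
      ∣ S m - S n ∣          ≡⟨ 0≤p⇒∣p∣≡p (p≤q⇒0≤q-p (partialSum-mono n≤m)) ⟩
      S m - S n              ≤⟨ p≤q+r⇒p-q≤r (partialSum-bounded halving-from-n n≤m) ⟩
      f n + f n              <⟨ +-mono-< f<½ε f<½ε ⟩
      ½ * ε + ½ * ε          ≡⟨ solve 1 (λ ε → con ½ :* ε :+ con ½ :* ε := ε) refl ε ⟩
      ε                      ∎
      where
      open ≤-Reasoning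
      halving-from-n : HalvingFrom f n
      halving-from-n k n≤k = halving k (ℕP.≤-trans (ℕP.m≤m⊔n N N′) (ℕP.≤-trans M≤n n≤k))
      f<½ε = proj₂ f-small n (ℕP.≤-trans (ℕP.m≤n⊔m N N′) M≤n)

    close : ∀ m n → M ℕ.≤ m → M ℕ.≤ n → ∣ S m - S n ∣ < ε
    close m n M≤m M≤n with ℕP.≤-total n m
    ... | inj₁ n≤m = ordered m n M≤n n≤m
    ... | inj₂ m≤n = subst (_< ε) (∣p-q∣≡∣q-p∣ (S n) (S m)) (ordered n m M≤m m≤n)

  limit-bounds : ∀ {L n} → ConvergesTo (partialSum f) L → HalvingFrom f n →
                 f n ≤ L - partialSum f n × L - partialSum f n ≤ f n + f n
  limit-bounds {n = n} S→L halving =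
      q+r≤p⇒r≤p-q (limit-≥ S→L (suc n , λ m → partialSum-mono))
    , p≤q+r⇒p-q≤r (limit-≤ S→L (n , λ m → partialSum-bounded halving))

∣-chain : ∀ (b : ℕ → ℕ) → (∀ n → b n ∣ b (suc n)) → ∀ {m n} → m ≤′ n → b m ∣ b n
∣-chain b step ≤′-refl       = ∣-refl
∣-chain b step (≤′-step m≤n) = ∣-trans (∣-chain b step m≤n) (step _)

module _ (a b : ℕ → ℕ) (apos : ∀ n → ℕ.NonZero (a n)) (bpos : ∀ n → ℕ.NonZero (b n)) where

  private
    C R A B : ℕ → ℚ
    C = c a b bpos
    R = ratioTerm a b apos bpos
    A n = fromℤ (+ a n)
    B n = fromℤ (+ b n)

  c-pos : ∀ n → 0ℚ < C n
  c-pos n = positive⁻¹ (C n) {{normalize-pos (a n) (b n) {{bpos n}} {{apos n}}}}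

  b-pos : ∀ n → 0ℚ < B n
  b-pos n = <-≤-trans (*<* (ℤ.+<+ (ℕ.s≤s ℕ.z≤n))) (1≤fromℕ (b n) {{bpos n}})

  b*c≡a : ∀ n → B n * C n ≡ A n
  b*c≡a n = fromℤ-cancel (+ a n) (b n) {{bpos n}}

  -- Since aₙ / cₙ = bₙ, the ratio term is Rₙ = bₙ cₙ₊₁.
  ratio≡b*c′ : ∀ n → R n ≡ B n * C (suc n)
  ratio≡b*c′ n = begin
    (+ a n / 1) * (C (suc n) * 1/cₙ)       ≡⟨ cong (_* (C (suc n) * 1/cₙ)) (z/1≡fromℤ (+ a n)) ⟩
    A n * (C (suc n) * 1/cₙ)               ≡⟨ cong (_* (C (suc n) * 1/cₙ)) (b*c≡a n) ⟨
    (B n * C n) * (C (suc n) * 1/cₙ)       ≡⟨ solve 4 (λ b c c′ i → (b :* c) :* (c′ :* i) := (b :* c′) :* (c :* i)) refl (B n) (C n) (C (suc n)) 1/cₙ ⟩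
    (B n * C (suc n)) * (C n * 1/cₙ)       ≡⟨ cong (B n * C (suc n) *_) (*-inverseʳ (C n) {{c-nonZero a b apos bpos n}}) ⟩
    (B n * C (suc n)) * 1ℚ                 ≡⟨ *-identityʳ _ ⟩
    B n * C (suc n)                        ∎
    where
    open ≡-Reasoning
    1/cₙ = (1/ C n) {{c-nonZero a b apos bpos n}}

  ratio*c≡a*c′ : ∀ n → R n * C n ≡ A n * C (suc n)
  ratio*c≡a*c′ n = begin
    R n * C n                  ≡⟨ cong (_* C n) (ratio≡b*c′ n) ⟩
    (B n * C (suc n)) * C n    ≡⟨ solve 3 (λ b c c′ → (b :* c′) :* c := (b :* c) :* c′) refl (B n) (C n) (C (suc n)) ⟩
    (B n * C n) * C (suc n)    ≡⟨ cong (_* C (suc n)) (b*c≡a n) ⟩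
    A n * C (suc n)            ∎
    where open ≡-Reasoning

  -- bₙ ≥ 1 gives cₙ₊₁ ≤ Rₙ.
  c′≤ratio : ∀ n → C (suc n) ≤ R n
  c′≤ratio n = begin
    C (suc n)            ≡⟨ *-identityˡ (C (suc n)) ⟨
    1ℚ * C (suc n)       ≤⟨ *-monoʳ-≤-nonNeg (C (suc n)) {{nonNegative (<⇒≤ (c-pos (suc n)))}} (1≤fromℕ (b n) {{bpos n}}) ⟩
    B n * C (suc n)      ≡⟨ ratio≡b*c′ n ⟨
    R n                  ∎
    where open ≤-Reasoning

  -- aₖ ≥ 1 gives 2cₖ₊₁ ≤ 2aₖcₖ₊₁ = 2Rₖcₖ, which is at most cₖ once Rₖ < ½.
  halves-when-ratio-small : ∀ k → R k < ½ → Halves C k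
  halves-when-ratio-small k Rₖ<½ = begin
    C (suc k) + C (suc k)                  ≤⟨ +-mono-≤ c′≤a*c′ c′≤a*c′ ⟩
    A k * C (suc k) + A k * C (suc k)      ≡⟨ cong₂ _+_ (ratio*c≡a*c′ k) (ratio*c≡a*c′ k) ⟨
    R k * C k + R k * C k                  ≡⟨ *-distribʳ-+ (C k) (R k) (R k) ⟨
    (R k + R k) * C k                      ≤⟨ *-monoʳ-≤-nonNeg (C k) {{nonNegative (<⇒≤ (c-pos k))}} (<⇒≤ (+-mono-< Rₖ<½ Rₖ<½)) ⟩
    1ℚ * C k                               ≡⟨ *-identityˡ (C k) ⟩
    C k                                    ∎
    where
    open ≤-Reasoning
    c′≤a*c′ : C (suc k) ≤ A k * C (suc k)
    c′≤a*c′ = subst (_≤ A k * C (suc k)) (*-identityˡ (C (suc k)))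
                (*-monoʳ-≤-nonNeg (C (suc k)) {{nonNegative (<⇒≤ (c-pos (suc k)))}} (1≤fromℕ (a k) {{apos k}}))

  -- From Rₙ → 0: the terms eventually halve, and cₙ → 0 because cₙ₊₁ ≤ Rₙ.
  eventually-halving : ConvergesTo R 0ℚ → Eventually (Halves C)
  eventually-halving R→0 with →0⇒eventually-< {R} R→0 ½ ½-pos
  ... | N , R<½ = N , λ k N≤k → halves-when-ratio-small k (R<½ k N≤k)

  c→0 : ConvergesTo R 0ℚ → ConvergesTo C 0ℚ
  c→0 R→0 ε ε>0 with →0⇒eventually-< {R} R→0 ε ε>0
  ... | N , R<ε = suc N , small
    where
    small : ∀ n → suc N ℕ.≤ n → ∣ C n - 0ℚ ∣ < ε
    small (suc k) (ℕ.s≤s N≤k) = begin-strict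
      ∣ C (suc k) - 0ℚ ∣     ≡⟨ cong ∣_∣ (+-identityʳ (C (suc k))) ⟩
      ∣ C (suc k) ∣          ≡⟨ 0≤p⇒∣p∣≡p (<⇒≤ (c-pos (suc k))) ⟩
      C (suc k)              ≤⟨ c′≤ratio k ⟩
      R k                    <⟨ R<ε k N≤k ⟩
      ε                      ∎
      where open ≤-Reasoning

  -- With b₀ ∣ b₁ ∣ …, each bₙ cₘ = (bₙ / bₘ) aₘ (m ≤ n) is an integer ...
  b*c-integer : (∀ n → b n ∣ b (suc n)) → ∀ {m n} → m ℕ.≤ n → IsInteger (B n * C m)
  b*c-integer chain {m} {n} m≤n with ∣-chain b chain (ℕP.≤⇒≤′ m≤n)
  ... | divides t bₙ≡t*bₘ = subst IsInteger (sym bₙcₘ≡t*aₘ) (integer-* (+ t , refl) (+ a m , refl))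
    where
    open ≡-Reasoning
    bₙcₘ≡t*aₘ : B n * C m ≡ fromℤ (+ t) * A m
    bₙcₘ≡t*aₘ = begin
      B n * C m                          ≡⟨ cong (λ k → fromℤ (+ k) * C m) bₙ≡t*bₘ ⟩
      fromℤ (+ (t ℕ.* b m)) * C m        ≡⟨ cong (λ z → fromℤ z * C m) (ℤP.pos-* t (b m)) ⟩
      fromℤ (+ t ℤ.* + b m) * C m        ≡⟨ cong (_* C m) (fromℤ-* (+ t) (+ b m)) ⟨
      (fromℤ (+ t) * B m) * C m          ≡⟨ *-assoc (fromℤ (+ t)) (B m) (C m) ⟩
      fromℤ (+ t) * (B m * C m)          ≡⟨ cong (fromℤ (+ t) *_) (b*c≡a m) ⟩
      fromℤ (+ t) * A m                  ∎

  b*partialSum-integer : (∀ n → b n ∣ b (suc n)) → ∀ n → IsInteger (B n * partialSum C (suc n))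
  b*partialSum-integer chain n =
    scaled-partialSum-integer (B n) C (suc n) (λ m m<1+n → b*c-integer chain (ℕP.≤-pred m<1+n))

  -- For a rational L with denominator q, the number q bₙ (L - Sₙ₊₁) = (q L) bₙ - q (bₙ Sₙ₊₁)
  -- is an integer.
  tail-integer : (∀ n → b n ∣ b (suc n)) → ∀ L n →
                 IsInteger (fromℤ (↧ L) * (B n * (L - partialSum C (suc n))))
  tail-integer chain L n = subst IsInteger
    (solve 4 (λ q l b s → (q :* l) :* b :+ :- (q :* (b :* s)) := q :* (b :* (l :- s)))
       refl (fromℤ (↧ L)) L (B n) (partialSum C (suc n)))
    (integer-+ (integer-* (denominator-clears L) (+ b n , refl))
               (integer-neg (integer-* (↧ L , refl) (b*partialSum-integer chain n))))

  b*≤2ratio : ∀ n {T} → T ≤ C (suc n) + C (suc n) → B n * T ≤ R n + R n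
  b*≤2ratio n {T} T≤2c = begin
    B n * T                                ≤⟨ *-monoˡ-≤-nonNeg (B n) {{nonNegative (<⇒≤ (b-pos n))}} T≤2c ⟩
    B n * (C (suc n) + C (suc n))          ≡⟨ *-distribˡ-+ (B n) (C (suc n)) (C (suc n)) ⟩
    B n * C (suc n) + B n * C (suc n)      ≡⟨ cong₂ _+_ (ratio≡b*c′ n) (ratio≡b*c′ n) ⟨
    R n + R n                              ∎
    where open ≤-Reasoning

  -- Suppose Sₙ → L and let q be the denominator of L.  Choose n with
  -- halving from n + 1 on and Rₙ < ε = 1/(2q); put T = L - Sₙ₊₁, so cₙ₊₁ ≤ T ≤ 2cₙ₊₁.
  -- Then the integer X = q bₙ T satisfies X > 0 and X ≤ 2q Rₙ < 1: impossible.
  sum-irrational : (∀ n → b n ∣ b (suc n)) → ConvergesTo R 0ℚ →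
                   ∀ L → ¬ ConvergesTo (partialSum C) L
  sum-irrational chain R→0 L S→L = no-integer-between-0-and-1 (tail-integer chain L n) X>0 X<1
    where
    Q = fromℤ (↧ L)
    ε = ½ * 1/ Q
    ε>0 : 0ℚ < ε
    ε>0 = positive⁻¹ ε {{pos*pos⇒pos ½ (1/ Q) {{1/pos⇒pos Q}}}}

    halving : Eventually (Halves C)
    halving = eventually-halving R→0
    ratio-small : Eventually (λ n → R n < ε)
    ratio-small = →0⇒eventually-< {R} R→0 ε ε>0
    N½ = proj₁ halving
    Nε = proj₁ ratio-small
    n = N½ ℕ.⊔ Nε
    S = partialSum C
    T = L - S (suc n)
    X = Q * (B n * T)

    halving-from : HalvingFrom C (suc n)
    halving-from k 1+n≤k = proj₂ halving k (ℕP.≤-trans (ℕP.m≤m⊔n N½ Nε) (ℕP.≤-trans (ℕP.n≤1+n n) 1+n≤k))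

    bounds : C (suc n) ≤ T × T ≤ C (suc n) + C (suc n)
    bounds = limit-bounds C (λ k → <⇒≤ (c-pos k)) S→L halving-from
    c≤T = proj₁ bounds
    T≤2c = proj₂ bounds

    X>0 : 0ℚ < X
    X>0 = positive⁻¹ X {{pos*pos⇒pos Q (B n * T)
            {{pos*pos⇒pos (B n) {{positive (b-pos n)}} T {{positive (<-≤-trans (c-pos (suc n)) c≤T)}}}}}}

    X<1 : X < 1ℚ
    X<1 = begin-strict
      Q * (B n * T)                              ≤⟨ *-monoˡ-≤-nonNeg Q (b*≤2ratio n T≤2c) ⟩
      Q * (R n + R n)                            <⟨ *-monoʳ-<-pos Q (+-mono-< Rₙ<ε Rₙ<ε) ⟩
      Q * (ε + ε)                                ≡⟨ solve 2 (λ q i → q :* (con ½ :* i :+ con ½ :* i) := q :* i) refl Q (1/ Q) ⟩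
      Q * 1/ Q                                   ≡⟨ *-inverseʳ Q ⟩
      1ℚ                                         ∎
      where
      open ≤-Reasoning
      Rₙ<ε = proj₂ ratio-small n (ℕP.m≤n⊔m N½ Nε)

theorem2 : (a b : ℕ → ℕ) (apos : ∀ n → ℕ.NonZero (a n)) (bpos : ∀ n → ℕ.NonZero (b n))
           → (∀ n → b n ∣ b (suc n))
           → ConvergesTo (ratioTerm a b apos bpos) 0ℚ
           → ConvergesToIrrational (partialSum (c a b bpos))
theorem2 a b apos bpos chain R→0 =
    halving-series-cauchy C (λ n → <⇒≤ (c-pos a b apos bpos n))
      (eventually-halving a b apos bpos R→0) (c→0 a b apos bpos R→0)
  , sum-irrational a b apos bpos chain R→0
  where C = c a b bpos
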